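{- Let $n\ge 2k>1$ and let $\mathcal F\subset\binom{[n]}{k}$ with $|\mathcal F|>\binom{n-1}{k-1}$. Define $\gamma:=|\mathcal F|/\binom{n-1}{k-1}$. Then $$d(\mathcal F)\ge\frac12\Big(1-\frac{c(2)k^3}{\gamma n}\Big)|\mathcal F|.$$
   Context: For $\mathcal F\subset\binom{[n]}{k}$, $d(\mathcal F)=\max_{F\in\mathcal F}|\{G\in\mathcal F:G\cap F=\emptyset\}|$. For $P\subset[n]$, $\mathcal F(P)=\{F\setminus P: P\subset F\in\mathcal F\}$. For $1\le i<k$, $c(i)=c(i,\mathcal F)=\binom{n-i}{k-i}^{ -1}\max\{|\mathcal F(P)|:P\in\binom{[n]}{i}\}$. -}

module Defs where

open import Data.Nat using (ℕ; zero; suc; _∸_; _⊔_)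
open import Data.Nat.Combinatorics using (_C_)
open import Data.Bool using (Bool; true; false)
import Data.Bool as B
open import Data.Vec using (_∷_; [])
open import Data.Vec.Properties using (≡-dec)
open import Data.List using (List; []; _∷_; map; filter; length; _++_; foldr)
open import Data.Fin.Subset using (Subset; _∩_; _⊆_; ∣_∣) renaming (⊥ to ∅)
open import Data.Fin.Subset.Properties using (_⊆?_)
open import Data.Integer using (+_)
open import Data.Rational using (ℚ; 0ℚ; _÷_; ≢-nonZero) renaming (_/_ to _/ℤ_)
import Data.Rational as Q
open import Data.Nat using (_≟_)
open import Relation.Nullary using (yes; no; Dec)
open import Relation.Binary.PropositionalEquality using (_≡_)

maxList : List ℕ → ℕ
maxList = foldr _⊔_ 0

allSubsets : (n : ℕ) → List (Subset n)
allSubsets zero = [] ∷ []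
allSubsets (suc n) = map (true ∷_) (allSubsets n) ++ map (false ∷_) (allSubsets n)

disjoint? : ∀ {n} (F G : Subset n) → Dec (F ∩ G ≡ ∅)
disjoint? F G = ≡-dec B._≟_ (F ∩ G) ∅

d : ∀ {n} → List (Subset n) → ℕ
d 𝓕 = maxList (map (λ F → length (filter (λ G → disjoint? G F) 𝓕)) 𝓕)

linkSize : ∀ {n} → List (Subset n) → Subset n → ℕ
linkSize 𝓕 P = length (filter (λ F → P ⊆? F) 𝓕)

maxLink : ∀ {n} → ℕ → List (Subset n) → ℕ
maxLink {n} i 𝓕 = maxList (map (linkSize 𝓕) (filter (λ P → ∣ P ∣ ≟ i) (allSubsets n)))

-- Quotient of naturals as a rational (convention: a / 0 = 0).
_÷ℕ_ : ℕ → ℕ → ℚ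
a ÷ℕ zero = 0ℚ
a ÷ℕ suc b = (+ a) /ℤ suc b

-- Total division on ℚ (convention: p / 0 = 0).
_÷ℚ_ : ℚ → ℚ → ℚ
p ÷ℚ q with q Q.≟ 0ℚ
... | yes _ = 0ℚ
... | no q≢0 = _÷_ p q {{≢-nonZero q≢0}}

c : (n k i : ℕ) → List (Subset n) → ℚ
c n k i 𝓕 = maxLink i 𝓕 ÷ℕ ((n ∸ i) C (k ∸ i))

γ : (n k : ℕ) → List (Subset n) → ℚ
γ n k 𝓕 = length 𝓕 ÷ℕ ((n ∸ 1) C (k ∸ 1))

toℚ : ℕ → ℚ
toℚ m = (+ m) /ℤ 1

-- Write Δ for maxLink 2 𝓕, the largest number of members containing a fixed pair.
-- If 𝓕 has two disjoint members F₁, F₂, every member is disjoint from F₁, disjoint from F₂,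
-- or contains a pair {x, y} with x ∈ F₁ and y ∈ F₂; there are k² such pairs, so
-- |𝓕| ≤ 2 d(𝓕) + k² Δ.  If 𝓕 is intersecting, then |𝓕| > C(n-1, k-1) means no point x
-- lies in every member, so some member G_x avoids x; then every member meets a fixed F ∈ 𝓕
-- in some x and meets G_x in some y ≠ x, and again |𝓕| ≤ k² Δ.  Finally
-- n C(n-2, k-2) ≤ k C(n-1, k-1) turns k² Δ = k² c(2) C(n-2, k-2) into at most
-- c(2) k³ |𝓕| / (γ n), and |𝓕| ≤ 2 d(𝓕) + k² Δ rearranges to the claim.
module Submission where

open import Defs
open import Data.Nat using (ℕ; _≤_; _<_; _*_; _^_)
open import Data.Nat.Combinatorics using (_C_)
open import Data.Nat using (_∸_)
open import Data.List using (List; length)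
open import Data.List.Relation.Unary.All using (All)
open import Data.List.Relation.Unary.Unique.Propositional using (Unique)
open import Data.Fin.Subset using (Subset; ∣_∣)
open import Data.Rational using (ℚ; 1ℚ; ½) renaming (_≤_ to _≤ℚ_; _*_ to _*ℚ_; _-_ to _-ℚ_)
open import Relation.Binary.PropositionalEquality using (_≡_)

open import Level using (Level)
open import Function using (_∘_; id)
open import Data.Empty using (⊥-elim)
open import Data.Product using (∃; _×_; _,_; proj₁; proj₂; map₂)
open import Data.Sum using (_⊎_; inj₁; inj₂)
open import Relation.Nullary using (yes; no; ¬_; ¬?; _⊎-dec_; contradiction)
open import Relation.Unary using (Pred; Decidable)
open import Relation.Binary.PropositionalEquality
  using (_≢_; refl; sym; trans; cong; cong₂; subst; ≢-sym; module ≡-Reasoning)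
open import Data.Nat as ℕ using (zero; suc; _+_; s≤s; z≤n)
import Data.Nat.Properties as ℕ
import Data.Nat.Tactic.RingSolver as ℕ-Solver
open import Data.Nat.Combinatorics using (nCk+nC[k+1]≡[n+1]C[k+1]; k>n⇒nCk≡0; nC1≡n)
open import Data.Nat.ListAction using (sum)
open import Data.Integer as ℤ using (1ℤ)
import Data.Integer.Properties as ℤ
import Data.Integer.Tactic.RingSolver as ℤ-Solver
open import Data.Rational as ℚ using (0ℚ)
import Data.Rational.Properties as ℚ
open import Data.Rational.Solver using (module +-*-Solver)
open import Data.Rational.Unnormalised as ℚᵘ using (mkℚᵘ; *≡*; *≤*)
import Data.Rational.Unnormalised.Properties as ℚᵘ
open import Data.Bool as Bool using (Bool)
open import Data.Fin using (Fin; zero; suc; fromℕ<)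
open import Data.Vec using ([]; _∷_; here; there)
open import Data.List using ([]; _∷_; map; filter)
import Data.List.Properties as List
open import Data.List.Relation.Unary.Any as Any using (Any; here; there; any?)
open import Data.List.Relation.Unary.All as All using ([]; _∷_)
open import Data.List.Relation.Unary.AllPairs using ([]; _∷_)
open import Data.List.Membership.Propositional using (find; lose) renaming (_∈_ to _∈ˡ_)
open import Data.List.Membership.Propositional.Properties
  using (∈-map⁺; ∈-map⁻; ∈-++⁺ˡ; ∈-++⁺ʳ; ∈-lookup; ∈-filter⁺; ∈-filter⁻)
open import Data.Fin.Subset using (_∈_; _∉_; _⊆_; _∩_; _∪_; ⁅_⁆; inside; outside) renaming (⊥ to ∅)
open import Data.Fin.Subset.Properties
  using (_⊆?_; _∈?_; nonempty?; Empty-unique; x∈p∩q⁺; x∈p∩q⁻; x∈p∪q⁻; ∉⊥; drop-∷-⊆; p⊆q⇒∣p∣≤∣q∣; ∣p∣≤n;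
         x∈⁅y⁆⇒x≡y; ∣⁅x⁆∣≡1; ∪-identityˡ; ∪-identityʳ)

private variable
  ℓ ℓ₁ ℓ₂ ℓ₃ ℓ₄ : Level
  A : Set ℓ
  I : Set ℓ₁

count : {P : Pred A ℓ₂} → Decidable P → List A → ℕ
count P? xs = length (filter P? xs)

module _ {P : Pred A ℓ₂} (P? : Decidable P) where

  count-accept : ∀ {x} xs → P x → count P? (x ∷ xs) ≡ suc (count P? xs)
  count-accept xs px = cong length (List.filter-accept P? {xs = xs} px)

  count-∷-≥ : ∀ x xs → count P? xs ≤ count P? (x ∷ xs)
  count-∷-≥ x xs with P? x
  ... | yes _ = ℕ.n≤1+n _
  ... | no _ = ℕ.≤-refl

  length≤count : ∀ xs → (∀ {x} → x ∈ˡ xs → P x) → length xs ≤ count P? xs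
  length≤count xs all = ℕ.≤-reflexive (cong length (sym (List.filter-all P? {xs} (All.tabulate all))))

  count≡0 : ∀ xs → (∀ {x} → x ∈ˡ xs → ¬ P x) → count P? xs ≡ 0
  count≡0 xs none = cong length (List.filter-none P? {xs} (All.tabulate none))

count-⊎ : {P : Pred A ℓ₂} {Q : Pred A ℓ₃} {R : Pred A ℓ₄} (P? : Decidable P) (Q? : Decidable Q) (R? : Decidable R) →
  (∀ {x} → R x → P x ⊎ Q x) → ∀ xs → count R? xs ≤ count P? xs + count Q? xs
count-⊎ P? Q? R? split [] = z≤n
count-⊎ P? Q? R? split (x ∷ xs) with R? x | count-⊎ P? Q? R? split xs
... | no _ | ih = ℕ.≤-trans ih (ℕ.+-mono-≤ (count-∷-≥ P? x xs) (count-∷-≥ Q? x xs))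
... | yes rx | ih with split rx
...   | inj₁ px = begin
  suc (count R? xs)                      ≤⟨ s≤s ih ⟩
  suc (count P? xs) + count Q? xs        ≡⟨ cong (_+ count Q? xs) (count-accept P? xs px) ⟨
  count P? (x ∷ xs) + count Q? xs        ≤⟨ ℕ.+-monoʳ-≤ (count P? (x ∷ xs)) (count-∷-≥ Q? x xs) ⟩
  count P? (x ∷ xs) + count Q? (x ∷ xs)  ∎
  where open ℕ.≤-Reasoning
...   | inj₂ qx = begin
  suc (count R? xs)                      ≤⟨ s≤s ih ⟩
  suc (count P? xs + count Q? xs)        ≡⟨ ℕ.+-suc (count P? xs) (count Q? xs) ⟨
  count P? xs + suc (count Q? xs)        ≡⟨ cong (count P? xs +_) (count-accept Q? xs qx) ⟨
  count P? xs + count Q? (x ∷ xs)        ≤⟨ ℕ.+-monoˡ-≤ (count Q? (x ∷ xs)) (count-∷-≥ P? x xs) ⟩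
  count P? (x ∷ xs) + count Q? (x ∷ xs)  ∎
  where open ℕ.≤-Reasoning

count-any≤sum : {R : I → Pred A ℓ₂} (R? : ∀ j → Decidable (R j)) (js : List I) (xs : List A) →
  count (λ x → any? (λ j → R? j x) js) xs ≤ sum (map (λ j → count (R? j) xs) js)
count-any≤sum R? [] xs = ℕ.≤-reflexive (count≡0 (λ x → any? (λ j → R? j x) []) xs (λ _ ()))
count-any≤sum R? (j ∷ js) xs = ℕ.≤-trans
  (count-⊎ (R? j) (λ x → any? (λ j → R? j x) js) (λ x → any? (λ j → R? j x) (j ∷ js)) Any.toSum xs)
  (ℕ.+-monoʳ-≤ (count (R? j) xs) (count-any≤sum R? js xs))

sum≤length*bound : ∀ (f : I → ℕ) b (js : List I) → (∀ {j} → j ∈ˡ js → f j ≤ b) → sum (map f js) ≤ length js * b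
sum≤length*bound f b [] _ = z≤n
sum≤length*bound f b (j ∷ js) bounded = ℕ.+-mono-≤ (bounded (here refl)) (sum≤length*bound f b js (bounded ∘ there))

maxList-≥ : (f : A → ℕ) → ∀ {x} {xs : List A} → x ∈ˡ xs → f x ≤ maxList (map f xs)
maxList-≥ f (here refl) = ℕ.m≤m⊔n _ _
maxList-≥ f {xs = y ∷ ys} (there x∈ys) = ℕ.≤-trans (maxList-≥ f x∈ys) (ℕ.m≤n⊔m (f y) _)

maxList-≤ : (f : A → ℕ) → ∀ {b} (xs : List A) → (∀ {x} → x ∈ˡ xs → f x ≤ b) → maxList (map f xs) ≤ b
maxList-≤ f [] _ = z≤n
maxList-≤ f (x ∷ xs) bounded = ℕ.⊔-lub (bounded (here refl)) (maxList-≤ f xs (bounded ∘ there))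

All-empty⇒length≡0 : {P : Pred A ℓ₂} {xs : List A} → All P xs → (∀ {x} → ¬ P x) → length xs ≡ 0
All-empty⇒length≡0 [] _ = refl
All-empty⇒length≡0 (px ∷ _) empty = ⊥-elim (empty px)

elements : ∀ {n} → Subset n → List (Fin n)
elements [] = []
elements (inside ∷ p) = zero ∷ map suc (elements p)
elements (outside ∷ p) = map suc (elements p)

length-elements : ∀ {n} (p : Subset n) → length (elements p) ≡ ∣ p ∣
length-elements [] = refl
length-elements (inside ∷ p) = cong suc (trans (List.length-map suc (elements p)) (length-elements p))
length-elements (outside ∷ p) = trans (List.length-map suc (elements p)) (length-elements p)

∈-elements⁺ : ∀ {n} {x : Fin n} {p : Subset n} → x ∈ p → x ∈ˡ elements p
∈-elements⁺ {p = inside ∷ p} here = here refl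
∈-elements⁺ {p = inside ∷ p} (there x∈p) = there (∈-map⁺ suc (∈-elements⁺ x∈p))
∈-elements⁺ {p = outside ∷ p} (there x∈p) = ∈-map⁺ suc (∈-elements⁺ x∈p)

∈-elements⁻ : ∀ {n} {x : Fin n} (p : Subset n) → x ∈ˡ elements p → x ∈ p
∈-elements⁻ (inside ∷ p) (here refl) = here
∈-elements⁻ (inside ∷ p) (there x∈ps) with ∈-map⁻ suc x∈ps
... | _ , y∈p , refl = there (∈-elements⁻ p y∈p)
∈-elements⁻ (outside ∷ p) x∈ps with ∈-map⁻ suc x∈ps
... | _ , y∈p , refl = there (∈-elements⁻ p y∈p)

∈-allSubsets : ∀ {n} (p : Subset n) → p ∈ˡ allSubsets n
∈-allSubsets [] = here refl
∈-allSubsets {suc n} (inside ∷ p) = ∈-++⁺ˡ (∈-map⁺ (inside ∷_) (∈-allSubsets p))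
∈-allSubsets {suc n} (outside ∷ p) = ∈-++⁺ʳ (map (inside ∷_) (allSubsets n)) (∈-map⁺ (outside ∷_) (∈-allSubsets p))

∩≢∅⇒common : ∀ {n} (p q : Subset n) → p ∩ q ≢ ∅ → ∃ λ x → x ∈ p × x ∈ q
∩≢∅⇒common p q p∩q≢∅ with nonempty? (p ∩ q)
... | yes (x , x∈p∩q) = x , x∈p∩q⁻ p q x∈p∩q
... | no p∩q-empty = contradiction (Empty-unique p∩q-empty) p∩q≢∅

pair : ∀ {n} → Fin n → Fin n → Subset n
pair x y = ⁅ x ⁆ ∪ ⁅ y ⁆

∣pair∣≡2 : ∀ {n} (x y : Fin n) → x ≢ y → ∣ pair x y ∣ ≡ 2
∣pair∣≡2 zero zero x≢y = contradiction refl x≢y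
∣pair∣≡2 zero (suc y) _ = cong suc (trans (cong ∣_∣ (∪-identityˡ ⁅ y ⁆)) (∣⁅x⁆∣≡1 y))
∣pair∣≡2 (suc x) zero _ = cong suc (trans (cong ∣_∣ (∪-identityʳ ⁅ x ⁆)) (∣⁅x⁆∣≡1 x))
∣pair∣≡2 (suc x) (suc y) x≢y = ∣pair∣≡2 x y (x≢y ∘ cong suc)

pair⊆ : ∀ {n} {x y : Fin n} {p : Subset n} → x ∈ p → y ∈ p → pair x y ⊆ p
pair⊆ {x = x} {y} x∈p y∈p z∈xy with x∈p∪q⁻ ⁅ x ⁆ ⁅ y ⁆ z∈xy
... | inj₁ z∈x rewrite x∈⁅y⁆⇒x≡y x z∈x = x∈p
... | inj₂ z∈y rewrite x∈⁅y⁆⇒x≡y y z∈y = y∈p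

withHead : ∀ {m} → Bool → List (Subset (suc m)) → List (Subset m)
withHead b [] = []
withHead b ((b′ ∷ p) ∷ xs) with b Bool.≟ b′
... | yes _ = p ∷ withHead b xs
... | no _ = withHead b xs

length-withHead : ∀ {m} (xs : List (Subset (suc m))) →
  length xs ≡ length (withHead inside xs) + length (withHead outside xs)
length-withHead [] = refl
length-withHead ((inside ∷ p) ∷ xs) = cong suc (length-withHead xs)
length-withHead ((outside ∷ p) ∷ xs) = trans (cong suc (length-withHead xs)) (sym (ℕ.+-suc _ _))

All-withHead : ∀ {m} {P : Pred (Subset (suc m)) ℓ} b {xs} → All P xs → All (λ p → P (b ∷ p)) (withHead b xs)
All-withHead b [] = []
All-withHead b {(b′ ∷ p) ∷ xs} (Pbp ∷ Pxs) with b Bool.≟ b′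
... | yes refl = Pbp ∷ All-withHead b Pxs
... | no _ = All-withHead b Pxs

Unique-withHead : ∀ {m} b {xs : List (Subset (suc m))} → Unique xs → Unique (withHead b xs)
Unique-withHead b [] = []
Unique-withHead b {(b′ ∷ p) ∷ xs} (p∉xs ∷ uxs) with b Bool.≟ b′
... | yes refl = All.map (λ bp≢bq p≡q → bp≢bq (cong (b ∷_) p≡q)) (All-withHead b p∉xs) ∷ Unique-withHead b uxs
... | no _ = Unique-withHead b uxs

withHead-⊇ : ∀ {m} b {s} {P : Subset m} {j xs} → All (λ S → s ∷ P ⊆ S × ∣ S ∣ ≡ j) xs →
  All (λ S → P ⊆ S × ∣ b ∷ S ∣ ≡ j) (withHead b xs)
withHead-⊇ b = All.map (λ (P⊆S , ∣S∣≡j) → (λ {_} → drop-∷-⊆ P⊆S) , ∣S∣≡j) ∘ All-withHead b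

length≤C : ∀ {m} (P : Subset m) k (xs : List (Subset m)) → Unique xs →
  All (λ S → P ⊆ S × ∣ S ∣ ≡ ∣ P ∣ + k) xs → length xs ≤ (m ∸ ∣ P ∣) C k
length≤C [] k [] _ _ = z≤n
length≤C [] k ([] ∷ []) _ ((_ , refl) ∷ []) = ℕ.≤-refl
length≤C [] k ([] ∷ [] ∷ _) ((≢ ∷ _) ∷ _) _ = contradiction refl ≢
length≤C {suc m} (inside ∷ P) k xs uxs P⊆xs = begin
  length xs                            ≡⟨ length-withHead xs ⟩
  length ins + length outs             ≡⟨ cong (length ins +_) (All-empty⇒length≡0 (All-withHead outside P⊆xs) no-outs) ⟩
  length ins + 0                       ≡⟨ ℕ.+-identityʳ _ ⟩
  length ins                           ≤⟨ length≤C P k ins (Unique-withHead inside uxs)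
                                            (All.map (map₂ ℕ.suc-injective) (withHead-⊇ inside P⊆xs)) ⟩
  (m ∸ ∣ P ∣) C k                      ∎
  where
  open ℕ.≤-Reasoning
  ins = withHead inside xs
  outs = withHead outside xs
  no-outs : ∀ {S} → ¬ (inside ∷ P ⊆ outside ∷ S × _)
  no-outs (P⊆S , _) = contradiction (P⊆S here) λ ()
length≤C {suc m} (outside ∷ P) zero xs uxs P⊆xs = begin
  length xs                            ≡⟨ length-withHead xs ⟩
  length ins + length outs             ≡⟨ cong (_+ length outs) (All-empty⇒length≡0 (withHead-⊇ inside P⊆xs) no-ins) ⟩
  length outs                          ≤⟨ length≤C P zero outs (Unique-withHead outside uxs) (withHead-⊇ outside P⊆xs) ⟩
  (m ∸ ∣ P ∣) C zero                   ≡⟨⟩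
  (suc m ∸ ∣ P ∣) C zero               ∎
  where
  open ℕ.≤-Reasoning
  ins = withHead inside xs
  outs = withHead outside xs
  no-ins : ∀ {S} → ¬ (P ⊆ S × suc ∣ S ∣ ≡ ∣ P ∣ + 0)
  no-ins (P⊆S , ∣S∣≡) = ℕ.n≮n _ (ℕ.≤-trans (ℕ.≤-reflexive (trans ∣S∣≡ (ℕ.+-identityʳ _))) (p⊆q⇒∣p∣≤∣q∣ P⊆S))
length≤C {suc m} (outside ∷ P) (suc k) xs uxs P⊆xs = begin
  length xs                            ≡⟨ length-withHead xs ⟩
  length ins + length outs             ≤⟨ ℕ.+-mono-≤ (length≤C P k ins (Unique-withHead inside uxs) P⊆ins)
                                                     (length≤C P (suc k) outs (Unique-withHead outside uxs) (withHead-⊇ outside P⊆xs)) ⟩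
  (m ∸ ∣ P ∣) C k + (m ∸ ∣ P ∣) C suc k  ≡⟨ nCk+nC[k+1]≡[n+1]C[k+1] (m ∸ ∣ P ∣) k ⟩
  suc (m ∸ ∣ P ∣) C suc k              ≡⟨ cong (_C suc k) (ℕ.+-∸-assoc 1 (∣p∣≤n P)) ⟨
  (suc m ∸ ∣ P ∣) C suc k              ∎
  where
  open ℕ.≤-Reasoning
  ins = withHead inside xs
  outs = withHead outside xs
  P⊆ins : All (λ S → P ⊆ S × ∣ S ∣ ≡ ∣ P ∣ + k) ins
  P⊆ins = All.map (map₂ (λ ∣S∣≡ → ℕ.suc-injective (trans ∣S∣≡ (ℕ.+-suc _ k)))) (withHead-⊇ inside P⊆xs)

nCk>0 : ∀ n k → k ≤ n → 0 < n C k
nCk>0 n zero _ = s≤s z≤n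
nCk>0 (suc n) (suc k) (s≤s k≤n) = ℕ.<-≤-trans (nCk>0 n k k≤n)
  (ℕ.≤-trans (ℕ.m≤m+n (n C k) (n C suc k)) (ℕ.≤-reflexive (nCk+nC[k+1]≡[n+1]C[k+1] n k)))

[k+1]*[n+1]C[k+1]≡[n+1]*nCk : ∀ n k → suc k * (suc n C suc k) ≡ suc n * (n C k)
[k+1]*[n+1]C[k+1]≡[n+1]*nCk zero zero = refl
[k+1]*[n+1]C[k+1]≡[n+1]*nCk zero (suc k) = begin
  suc (suc k) * (1 C suc (suc k))  ≡⟨ cong (suc (suc k) *_) (k>n⇒nCk≡0 {1} {suc (suc k)} (s≤s (s≤s z≤n))) ⟩
  suc (suc k) * 0                  ≡⟨ ℕ.*-zeroʳ (suc (suc k)) ⟩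
  0                                ≡⟨ cong (_+ 0) (k>n⇒nCk≡0 {0} {suc k} (s≤s z≤n)) ⟨
  1 * (0 C suc k)                  ∎
  where open ≡-Reasoning
[k+1]*[n+1]C[k+1]≡[n+1]*nCk (suc n) zero =
  trans (ℕ.+-identityʳ _) (trans (nC1≡n (suc (suc n))) (sym (ℕ.*-identityʳ (suc (suc n)))))
[k+1]*[n+1]C[k+1]≡[n+1]*nCk (suc n) (suc k) = begin
  suc (suc k) * (suc (suc n) C suc (suc k))  ≡⟨ cong (suc (suc k) *_) (nCk+nC[k+1]≡[n+1]C[k+1] (suc n) (suc k)) ⟨
  suc (suc k) * (a + b)                      ≡⟨ expand a b k ⟩
  a + suc k * a + suc (suc k) * b            ≡⟨ cong₂ (λ u v → a + u + v) ([k+1]*[n+1]C[k+1]≡[n+1]*nCk n k)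
                                                                      ([k+1]*[n+1]C[k+1]≡[n+1]*nCk n (suc k)) ⟩
  a + suc n * (n C k) + suc n * (n C suc k)  ≡⟨ collect a n (n C k) (n C suc k) ⟩
  a + suc n * (n C k + n C suc k)            ≡⟨ cong (λ z → a + suc n * z) (nCk+nC[k+1]≡[n+1]C[k+1] n k) ⟩
  suc (suc n) * a                            ∎
  where
  open ≡-Reasoning
  a = suc n C suc k
  b = suc n C suc (suc k)
  expand : ∀ a b k → suc (suc k) * (a + b) ≡ a + suc k * a + suc (suc k) * b
  expand = ℕ-Solver.solve-∀
  collect : ∀ a n x y → a + suc n * x + suc n * y ≡ a + suc n * (x + y)
  collect = ℕ-Solver.solve-∀

nCk*[n+2]≤[k+2]*[n+1]C[k+1] : ∀ n k → k ≤ n → (n C k) * (2 + n) ≤ (2 + k) * (suc n C suc k)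
nCk*[n+2]≤[k+2]*[n+1]C[k+1] n k k≤n = ℕ.*-cancelˡ-≤ (suc k) (begin
  suc k * ((n C k) * (2 + n))          ≡⟨ lhs k (n C k) n ⟩
  (k * n + n + 2 + k + k) * (n C k)    ≤⟨ ℕ.*-monoˡ-≤ (n C k) (ℕ.+-monoʳ-≤ (k * n + n + 2 + k) k≤n) ⟩
  (k * n + n + 2 + k + n) * (n C k)    ≡⟨ rhs k (n C k) n ⟩
  (2 + k) * (suc n * (n C k))          ≡⟨ cong ((2 + k) *_) ([k+1]*[n+1]C[k+1]≡[n+1]*nCk n k) ⟨
  (2 + k) * (suc k * (suc n C suc k))  ≡⟨ swap k (suc n C suc k) ⟩
  suc k * ((2 + k) * (suc n C suc k))  ∎)
  where
  open ℕ.≤-Reasoning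
  lhs : ∀ k c n → suc k * (c * (2 + n)) ≡ (k * n + n + 2 + k + k) * c
  lhs = ℕ-Solver.solve-∀
  rhs : ∀ k c n → (k * n + n + 2 + k + n) * c ≡ (2 + k) * (suc n * c)
  rhs = ℕ-Solver.solve-∀
  swap : ∀ k a → (2 + k) * (suc k * a) ≡ suc k * ((2 + k) * a)
  swap = ℕ-Solver.solve-∀

toℚᵘ-toℚ : ∀ a → ℚ.toℚᵘ (toℚ a) ℚᵘ.≃ mkℚᵘ (ℤ.+ a) 0
toℚᵘ-toℚ a = ℚ.toℚᵘ-fromℚᵘ (mkℚᵘ (ℤ.+ a) 0)

toℚ-+ : ∀ a b → toℚ (a + b) ≡ toℚ a ℚ.+ toℚ b
toℚ-+ a b = ℚ.toℚᵘ-injective (begin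
  ℚ.toℚᵘ (toℚ (a + b))                    ≈⟨ toℚᵘ-toℚ (a + b) ⟩
  mkℚᵘ (ℤ.+ (a + b)) 0                    ≈⟨ *≡* (trans (cong (ℤ._* 1ℤ) (ℤ.pos-+ a b)) (cross (ℤ.+ a) (ℤ.+ b))) ⟩
  mkℚᵘ (ℤ.+ a) 0 ℚᵘ.+ mkℚᵘ (ℤ.+ b) 0      ≈⟨ ℚᵘ.+-cong (toℚᵘ-toℚ a) (toℚᵘ-toℚ b) ⟨
  ℚ.toℚᵘ (toℚ a) ℚᵘ.+ ℚ.toℚᵘ (toℚ b)      ≈⟨ ℚ.toℚᵘ-homo-+ (toℚ a) (toℚ b) ⟨
  ℚ.toℚᵘ (toℚ a ℚ.+ toℚ b)                ∎)
  where
  open ℚᵘ.≃-Reasoning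
  cross : ∀ x y → (x ℤ.+ y) ℤ.* 1ℤ ≡ (x ℤ.* 1ℤ ℤ.+ y ℤ.* 1ℤ) ℤ.* 1ℤ
  cross = ℤ-Solver.solve-∀

toℚ-* : ∀ a b → toℚ (a * b) ≡ toℚ a ℚ.* toℚ b
toℚ-* a b = ℚ.toℚᵘ-injective (begin
  ℚ.toℚᵘ (toℚ (a * b))                    ≈⟨ toℚᵘ-toℚ (a * b) ⟩
  mkℚᵘ (ℤ.+ (a * b)) 0                    ≈⟨ *≡* (cong (ℤ._* 1ℤ) (ℤ.pos-* a b)) ⟩
  mkℚᵘ (ℤ.+ a) 0 ℚᵘ.* mkℚᵘ (ℤ.+ b) 0      ≈⟨ ℚᵘ.*-cong (toℚᵘ-toℚ a) (toℚᵘ-toℚ b) ⟨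
  ℚ.toℚᵘ (toℚ a) ℚᵘ.* ℚ.toℚᵘ (toℚ b)      ≈⟨ ℚ.toℚᵘ-homo-* (toℚ a) (toℚ b) ⟨
  ℚ.toℚᵘ (toℚ a ℚ.* toℚ b)                ∎)
  where open ℚᵘ.≃-Reasoning

toℚ-mono-≤ : ∀ {a b} → a ≤ b → toℚ a ℚ.≤ toℚ b
toℚ-mono-≤ {a} {b} a≤b = ℚ.toℚᵘ-cancel-≤ (begin
  ℚ.toℚᵘ (toℚ a)    ≃⟨ toℚᵘ-toℚ a ⟩
  mkℚᵘ (ℤ.+ a) 0    ≤⟨ *≤* (ℤ.*-monoʳ-≤-nonNeg 1ℤ (ℤ.+≤+ a≤b)) ⟩
  mkℚᵘ (ℤ.+ b) 0    ≃⟨ toℚᵘ-toℚ b ⟨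
  ℚ.toℚᵘ (toℚ b)    ∎)
  where open ℚᵘ.≤-Reasoning

toℚ-pos : ∀ a → ℚ.Positive (toℚ (suc a))
toℚ-pos a = ℚ.normalize-pos (suc a) 1

÷ℕ-*-cancel : ∀ a b → (a ÷ℕ suc b) ℚ.* toℚ (suc b) ≡ toℚ a
÷ℕ-*-cancel a b = ℚ.toℚᵘ-injective (begin
  ℚ.toℚᵘ ((a ÷ℕ suc b) ℚ.* toℚ (suc b))          ≈⟨ ℚ.toℚᵘ-homo-* (a ÷ℕ suc b) (toℚ (suc b)) ⟩
  ℚ.toℚᵘ (a ÷ℕ suc b) ℚᵘ.* ℚ.toℚᵘ (toℚ (suc b))  ≈⟨ ℚᵘ.*-cong (ℚ.toℚᵘ-fromℚᵘ (mkℚᵘ (ℤ.+ a) b)) (toℚᵘ-toℚ (suc b)) ⟩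
  mkℚᵘ (ℤ.+ a) b ℚᵘ.* mkℚᵘ (ℤ.+ suc b) 0        ≈⟨ *≡* (cross (ℤ.+ a) (ℤ.+ suc b)) ⟩
  mkℚᵘ (ℤ.+ a) 0                                ≈⟨ toℚᵘ-toℚ a ⟨
  ℚ.toℚᵘ (toℚ a)                                ∎)
  where
  open ℚᵘ.≃-Reasoning
  cross : ∀ x y → (x ℤ.* y) ℤ.* 1ℤ ≡ x ℤ.* (y ℤ.* 1ℤ)
  cross = ℤ-Solver.solve-∀

÷ℚ-*-cancel : ∀ p q → q ≢ 0ℚ → (p ÷ℚ q) ℚ.* q ≡ p
÷ℚ-*-cancel p q q≢0 with q ℚ.≟ 0ℚ
... | yes q≡0 = contradiction q≡0 q≢0
... | no q≢0′ = begin
  p ℚ.* ℚ.1/ q ℚ.* q    ≡⟨ ℚ.*-assoc p (ℚ.1/ q) q ⟩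
  p ℚ.* (ℚ.1/ q ℚ.* q)  ≡⟨ cong (p ℚ.*_) (ℚ.*-inverseˡ q) ⟩
  p ℚ.* 1ℚ              ≡⟨ ℚ.*-identityʳ p ⟩
  p                     ∎
  where
  open ≡-Reasoning
  instance _ = ℚ.≢-nonZero q≢0′

half-deficit≤ : ∀ q L D x → toℚ x ℚ.≤ q ℚ.* toℚ L → L ≤ D + D + x → (½ ℚ.* (1ℚ ℚ.- q)) ℚ.* toℚ L ℚ.≤ toℚ D
half-deficit≤ q L D x x≤qL L≤2D+x = begin
  (½ ℚ.* (1ℚ ℚ.- q)) ℚ.* L′        ≡⟨ solve 3 (λ h q l → h :* (con 1ℚ :- q) :* l := h :* (l :- q :* l)) refl ½ q L′ ⟩
  ½ ℚ.* (L′ ℚ.- q ℚ.* L′)          ≤⟨ ℚ.*-monoˡ-≤-nonNeg ½ (ℚ.+-monoʳ-≤ L′ (ℚ.neg-antimono-≤ x≤qL)) ⟩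
  ½ ℚ.* (L′ ℚ.- x′)                ≤⟨ ℚ.*-monoˡ-≤-nonNeg ½ (ℚ.+-monoˡ-≤ (ℚ.- x′) L′≤2D′+x′) ⟩
  ½ ℚ.* (D′ ℚ.+ D′ ℚ.+ x′ ℚ.- x′)  ≡⟨ solve 3 (λ h d x → h :* (d :+ d :+ x :- x) := (h :+ h) :* d) refl ½ D′ x′ ⟩
  (½ ℚ.+ ½) ℚ.* D′                 ≡⟨ ℚ.*-identityˡ D′ ⟩
  D′                               ∎
  where
  open ℚ.≤-Reasoning
  open +-*-Solver
  L′ D′ x′ : ℚ
  L′ = toℚ L
  D′ = toℚ D
  x′ = toℚ x
  L′≤2D′+x′ : L′ ℚ.≤ D′ ℚ.+ D′ ℚ.+ x′
  L′≤2D′+x′ = subst (L′ ℚ.≤_) (trans (toℚ-+ (D + D) x) (cong (ℚ._+ x′) (toℚ-+ D D))) (toℚ-mono-≤ L≤2D+x)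

-- With q the displayed fraction, q L = Δ k³ A / (B n); multiplying through by B n reduces the
-- claim to the hypothesis scaled by k².
deficit-lower-bound : ∀ Δ B A L n k → 0 < B → 0 < A → 0 < L → 0 < n →
  Δ * (B * n) ≤ Δ * (k * A) →
  toℚ (k * (k * Δ)) ℚ.≤ (((Δ ÷ℕ B) ℚ.* toℚ (k ^ 3)) ÷ℚ ((L ÷ℕ A) ℚ.* toℚ n)) ℚ.* toℚ L
deficit-lower-bound Δ (suc B) (suc A) (suc L) (suc n) k _ _ _ _ ΔBn≤ΔkA =
  ℚ.*-cancelʳ-≤-pos (toℚ (suc n * suc B)) {{toℚ-pos (B + n * suc B)}} claim-times-Bn
  where
  Δ/B L/A K³ L′ N α β q : ℚ
  Δ/B = Δ ÷ℕ suc B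
  L/A = suc L ÷ℕ suc A
  K³ = toℚ (k ^ 3)
  L′ = toℚ (suc L)
  N = toℚ (suc n)
  α = toℚ (suc A)
  β = toℚ (suc B)
  q = (Δ/B ℚ.* K³) ÷ℚ (L/A ℚ.* N)
  L/A*N≢0 : L/A ℚ.* N ≢ 0ℚ
  L/A*N≢0 = ≢-sym (ℚ.<⇒≢ (ℚ.positive⁻¹ (L/A ℚ.* N) {{L/A*N>0}}))
    where L/A*N>0 = ℚ.pos*pos⇒pos L/A {{ℚ.normalize-pos (suc L) (suc A)}} N {{toℚ-pos n}}
  rearrangeˡ : ∀ k Δ n B → k * (k * Δ) * (n * B) ≡ k * k * (Δ * (B * n))
  rearrangeˡ = ℕ-Solver.solve-∀
  rearrangeʳ : ∀ k Δ A → k * k * (Δ * (k * A)) ≡ Δ * (k * (k * (k * 1))) * A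
  rearrangeʳ = ℕ-Solver.solve-∀
  scaled : k * (k * Δ) * (suc n * suc B) ≤ Δ * k ^ 3 * suc A
  scaled = begin
    k * (k * Δ) * (suc n * suc B)  ≡⟨ rearrangeˡ k Δ (suc n) (suc B) ⟩
    k * k * (Δ * (suc B * suc n))  ≤⟨ ℕ.*-monoʳ-≤ (k * k) ΔBn≤ΔkA ⟩
    k * k * (Δ * (k * suc A))      ≡⟨ rearrangeʳ k Δ (suc A) ⟩
    Δ * k ^ 3 * suc A              ∎
    where open ℕ.≤-Reasoning
  qLBn≡ΔK³A : q ℚ.* L′ ℚ.* toℚ (suc n * suc B) ≡ toℚ (Δ * k ^ 3 * suc A)
  qLBn≡ΔK³A = begin
    q ℚ.* L′ ℚ.* toℚ (suc n * suc B)  ≡⟨ cong₂ (λ l z → q ℚ.* l ℚ.* z) (÷ℕ-*-cancel (suc L) A)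
                                                                        (sym (toℚ-* (suc n) (suc B))) ⟨
    q ℚ.* (L/A ℚ.* α) ℚ.* (N ℚ.* β)   ≡⟨ solve 5 (λ q γ α N β → q :* (γ :* α) :* (N :* β) := q :* (γ :* N) :* (α :* β))
                                               refl q L/A α N β ⟩
    q ℚ.* (L/A ℚ.* N) ℚ.* (α ℚ.* β)   ≡⟨ cong (ℚ._* (α ℚ.* β)) (÷ℚ-*-cancel (Δ/B ℚ.* K³) (L/A ℚ.* N) L/A*N≢0) ⟩
    Δ/B ℚ.* K³ ℚ.* (α ℚ.* β)          ≡⟨ solve 4 (λ c K α β → c :* K :* (α :* β) := c :* β :* K :* α) refl Δ/B K³ α β ⟩
    Δ/B ℚ.* β ℚ.* K³ ℚ.* α            ≡⟨ cong (λ z → z ℚ.* K³ ℚ.* α) (÷ℕ-*-cancel Δ B) ⟩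
    toℚ Δ ℚ.* K³ ℚ.* α                ≡⟨ cong (ℚ._* α) (toℚ-* Δ (k ^ 3)) ⟨
    toℚ (Δ * k ^ 3) ℚ.* α             ≡⟨ toℚ-* (Δ * k ^ 3) (suc A) ⟨
    toℚ (Δ * k ^ 3 * suc A)           ∎
    where
    open ≡-Reasoning
    open +-*-Solver
  claim-times-Bn : toℚ (k * (k * Δ)) ℚ.* toℚ (suc n * suc B) ℚ.≤ q ℚ.* L′ ℚ.* toℚ (suc n * suc B)
  claim-times-Bn = begin
    toℚ (k * (k * Δ)) ℚ.* toℚ (suc n * suc B)  ≡⟨ toℚ-* (k * (k * Δ)) (suc n * suc B) ⟨
    toℚ (k * (k * Δ) * (suc n * suc B))        ≤⟨ toℚ-mono-≤ scaled ⟩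
    toℚ (Δ * k ^ 3 * suc A)                    ≡⟨ qLBn≡ΔK³A ⟨
    q ℚ.* L′ ℚ.* toℚ (suc n * suc B)           ∎
    where open ℚ.≤-Reasoning

Crossing : ∀ {n} → Subset n → (Fin n → Subset n) → Pred (Subset n) _
Crossing A f G = Any (λ x → Any (λ y → pair x y ⊆ G) (elements (f x))) (elements A)

crossing? : ∀ {n} (A : Subset n) (f : Fin n → Subset n) → Decidable (Crossing A f)
crossing? A f G = any? (λ x → any? (λ y → pair x y ⊆? G) (elements (f x))) (elements A)

crossing⁺ : ∀ {n} {A : Subset n} {f G x y} → x ∈ A → y ∈ f x → x ∈ G → y ∈ G → Crossing A f G
crossing⁺ x∈A y∈fx x∈G y∈G = lose (∈-elements⁺ x∈A) (lose (∈-elements⁺ y∈fx) (pair⊆ x∈G y∈G))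

module _ {n} (𝓕 : List (Subset n)) where

  count-disjoint≤d : ∀ {F} → F ∈ˡ 𝓕 → count (λ G → disjoint? G F) 𝓕 ≤ d 𝓕
  count-disjoint≤d = maxList-≥ (λ F → count (λ G → disjoint? G F) 𝓕)

  linkSize≤maxLink : ∀ {i} P → ∣ P ∣ ≡ i → linkSize 𝓕 P ≤ maxLink i 𝓕
  linkSize≤maxLink {i} P ∣P∣≡i = maxList-≥ (linkSize 𝓕) (∈-filter⁺ (λ P → ∣ P ∣ ℕ.≟ i) (∈-allSubsets P) ∣P∣≡i)

  maxLink≡0 : ∀ i → All (λ F → ∣ F ∣ < i) 𝓕 → maxLink i 𝓕 ≡ 0
  maxLink≡0 i small = ℕ.n≤0⇒n≡0 (maxList-≤ (linkSize 𝓕) _ (ℕ.≤-reflexive ∘ contained-in-none))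
    where
    contained-in-none : ∀ {P} → P ∈ˡ filter (λ P → ∣ P ∣ ℕ.≟ i) (allSubsets n) → linkSize 𝓕 P ≡ 0
    contained-in-none {P} P∈ = count≡0 (P ⊆?_) 𝓕 λ F∈𝓕 P⊆F →
      ℕ.<⇒≱ (All.lookup small F∈𝓕) (ℕ.≤-trans (ℕ.≤-reflexive (sym ∣P∣≡i)) (p⊆q⇒∣p∣≤∣q∣ P⊆F))
      where ∣P∣≡i = proj₂ (∈-filter⁻ (λ P → ∣ P ∣ ℕ.≟ i) {xs = allSubsets n} P∈)

  count-crossing≤ : ∀ {k} A f → (∀ {x} → x ∈ A → ∣ f x ∣ ≡ k) → (∀ {x} → x ∈ A → x ∉ f x) →
    count (crossing? A f) 𝓕 ≤ ∣ A ∣ * (k * maxLink 2 𝓕)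
  count-crossing≤ {k} A f ∣fx∣≡k x∉fx = begin
    count (crossing? A f) 𝓕                        ≤⟨ count-any≤sum R? (elements A) 𝓕 ⟩
    sum (map (λ x → count (R? x) 𝓕) (elements A))  ≤⟨ sum≤length*bound _ _ (elements A) (count-R≤ ∘ ∈-elements⁻ A) ⟩
    length (elements A) * (k * maxLink 2 𝓕)        ≡⟨ cong (_* (k * maxLink 2 𝓕)) (length-elements A) ⟩
    ∣ A ∣ * (k * maxLink 2 𝓕)                      ∎
    where
    open ℕ.≤-Reasoning
    R? : ∀ x → Decidable (λ G → Any (λ y → pair x y ⊆ G) (elements (f x)))
    R? x G = any? (λ y → pair x y ⊆? G) (elements (f x))
    count-R≤ : ∀ {x} → x ∈ A → count (R? x) 𝓕 ≤ k * maxLink 2 𝓕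
    count-R≤ {x} x∈A = begin
      count (R? x) 𝓕                                            ≤⟨ count-any≤sum (λ y → pair x y ⊆?_) (elements (f x)) 𝓕 ⟩
      sum (map (λ y → linkSize 𝓕 (pair x y)) (elements (f x)))  ≤⟨ sum≤length*bound _ _ (elements (f x)) pair≤ ⟩
      length (elements (f x)) * maxLink 2 𝓕                     ≡⟨ cong (_* maxLink 2 𝓕) (trans (length-elements (f x)) (∣fx∣≡k x∈A)) ⟩
      k * maxLink 2 𝓕                                           ∎
      where
      pair≤ : ∀ {y} → y ∈ˡ elements (f x) → linkSize 𝓕 (pair x y) ≤ maxLink 2 𝓕
      pair≤ {y} y∈ = linkSize≤maxLink (pair x y) (∣pair∣≡2 x y λ {refl → x∉fx x∈A (∈-elements⁻ (f x) y∈)})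

  module _ {k} (sizes : All (λ F → ∣ F ∣ ≡ k) 𝓕) where

    length≤2d+k²Δ-disjoint : ∀ {F₁ F₂} → F₁ ∈ˡ 𝓕 → F₂ ∈ˡ 𝓕 → F₁ ∩ F₂ ≡ ∅ →
      length 𝓕 ≤ d 𝓕 + d 𝓕 + k * (k * maxLink 2 𝓕)
    length≤2d+k²Δ-disjoint {F₁} {F₂} F₁∈𝓕 F₂∈𝓕 F₁∩F₂≡∅ = begin
      length 𝓕                                  ≤⟨ length≤count Covered? 𝓕 (λ _ → covered) ⟩
      count Covered? 𝓕                          ≤⟨ count-⊎ D₁? D₂⊎C? Covered? id 𝓕 ⟩
      count D₁? 𝓕 + count D₂⊎C? 𝓕               ≤⟨ ℕ.+-monoʳ-≤ (count D₁? 𝓕) (count-⊎ D₂? C? D₂⊎C? id 𝓕) ⟩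
      count D₁? 𝓕 + (count D₂? 𝓕 + count C? 𝓕)  ≤⟨ ℕ.+-mono-≤ (count-disjoint≤d F₁∈𝓕)
                                                               (ℕ.+-mono-≤ (count-disjoint≤d F₂∈𝓕) crossing≤) ⟩
      d 𝓕 + (d 𝓕 + k * (k * maxLink 2 𝓕))       ≡⟨ ℕ.+-assoc (d 𝓕) (d 𝓕) _ ⟨
      d 𝓕 + d 𝓕 + k * (k * maxLink 2 𝓕)         ∎
      where
      open ℕ.≤-Reasoning
      D₁? D₂? C? D₂⊎C? Covered? : Decidable _
      D₁? G = disjoint? G F₁
      D₂? G = disjoint? G F₂
      C? = crossing? F₁ (λ _ → F₂)
      D₂⊎C? G = D₂? G ⊎-dec C? G
      Covered? G = D₁? G ⊎-dec D₂⊎C? G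
      covered : ∀ {G} → G ∩ F₁ ≡ ∅ ⊎ G ∩ F₂ ≡ ∅ ⊎ Crossing F₁ (λ _ → F₂) G
      covered {G} with D₁? G | D₂? G
      ... | yes G∩F₁≡∅ | _ = inj₁ G∩F₁≡∅
      ... | no _ | yes G∩F₂≡∅ = inj₂ (inj₁ G∩F₂≡∅)
      ... | no G∩F₁≢∅ | no G∩F₂≢∅ with ∩≢∅⇒common G F₁ G∩F₁≢∅ | ∩≢∅⇒common G F₂ G∩F₂≢∅
      ...   | x , x∈G , x∈F₁ | y , y∈G , y∈F₂ = inj₂ (inj₂ (crossing⁺ x∈F₁ y∈F₂ x∈G y∈G))
      F₁∌F₂ : ∀ {x} → x ∈ F₁ → x ∉ F₂
      F₁∌F₂ {x} x∈F₁ x∈F₂ = ∉⊥ (subst (x ∈_) F₁∩F₂≡∅ (x∈p∩q⁺ (x∈F₁ , x∈F₂)))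
      crossing≤ : count C? 𝓕 ≤ k * (k * maxLink 2 𝓕)
      crossing≤ = subst (count C? 𝓕 ≤_) (cong (_* (k * maxLink 2 𝓕)) (All.lookup sizes F₁∈𝓕))
        (count-crossing≤ F₁ (λ _ → F₂) (λ _ → All.lookup sizes F₂∈𝓕) F₁∌F₂)

    length≤k²Δ-intersecting : ∀ {F} → F ∈ˡ 𝓕 → (∀ {G H} → G ∈ˡ 𝓕 → H ∈ˡ 𝓕 → G ∩ H ≢ ∅) →
      (∀ x → ∃ λ G → G ∈ˡ 𝓕 × x ∉ G) → length 𝓕 ≤ k * (k * maxLink 2 𝓕)
    length≤k²Δ-intersecting {F} F∈𝓕 intersecting avoid = begin
      length 𝓕                   ≤⟨ length≤count (crossing? F f) 𝓕 covered ⟩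
      count (crossing? F f) 𝓕    ≤⟨ count-crossing≤ F f (λ {x} _ → All.lookup sizes (f∈𝓕 x)) (λ {x} _ → x∉f x) ⟩
      ∣ F ∣ * (k * maxLink 2 𝓕)  ≡⟨ cong (_* (k * maxLink 2 𝓕)) (All.lookup sizes F∈𝓕) ⟩
      k * (k * maxLink 2 𝓕)      ∎
      where
      open ℕ.≤-Reasoning
      f : Fin n → Subset n
      f x = proj₁ (avoid x)
      f∈𝓕 : ∀ x → f x ∈ˡ 𝓕
      f∈𝓕 x = proj₁ (proj₂ (avoid x))
      x∉f : ∀ x → x ∉ f x
      x∉f x = proj₂ (proj₂ (avoid x))
      covered : ∀ {G} → G ∈ˡ 𝓕 → Crossing F f G
      covered G∈𝓕 with ∩≢∅⇒common _ F (intersecting G∈𝓕 F∈𝓕)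
      ... | x , x∈G , x∈F with ∩≢∅⇒common _ (f x) (intersecting G∈𝓕 (f∈𝓕 x))
      ...   | y , y∈G , y∈fx = crossing⁺ {f = f} x∈F y∈fx x∈G y∈G

  avoiding : ∀ {k} → Unique 𝓕 → All (λ F → ∣ F ∣ ≡ suc k) 𝓕 → (n ∸ 1) C k < length 𝓕 →
    ∀ x → ∃ λ G → G ∈ˡ 𝓕 × x ∉ G
  avoiding {k} unique sizes large x with any? (λ G → ¬? (x ∈? G)) 𝓕
  ... | yes some-avoids = find some-avoids
  ... | no none-avoids = contradiction (subst (λ i → length 𝓕 ≤ (n ∸ i) C k) (∣⁅x⁆∣≡1 x) star-bound) (ℕ.<⇒≱ large)
    where
    x∈ : ∀ {G} → G ∈ˡ 𝓕 → x ∈ G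
    x∈ {G} G∈𝓕 with x ∈? G
    ... | yes x∈G = x∈G
    ... | no x∉G = contradiction (lose G∈𝓕 x∉G) none-avoids
    star-bound : length 𝓕 ≤ (n ∸ ∣ ⁅ x ⁆ ∣) C k
    star-bound = length≤C ⁅ x ⁆ k 𝓕 unique (All.tabulate λ {G} G∈𝓕 →
      (λ y∈⁅x⁆ → subst (_∈ G) (sym (x∈⁅y⁆⇒x≡y x y∈⁅x⁆)) (x∈ G∈𝓕)) ,
      trans (All.lookup sizes G∈𝓕) (cong (_+ k) (sym (∣⁅x⁆∣≡1 x))))

  length≤2d+k²Δ : ∀ {k} → Unique 𝓕 → All (λ F → ∣ F ∣ ≡ suc k) 𝓕 → (n ∸ 1) C k < length 𝓕 →
    length 𝓕 ≤ d 𝓕 + d 𝓕 + suc k * (suc k * maxLink 2 𝓕)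
  length≤2d+k²Δ unique sizes large with any? (λ F₁ → any? (λ F₂ → disjoint? F₁ F₂) 𝓕) 𝓕
  ... | yes disjoint-pair =
    let F₁ , F₁∈𝓕 , F₂-disjoint = find disjoint-pair
        F₂ , F₂∈𝓕 , F₁∩F₂≡∅ = find F₂-disjoint
    in length≤2d+k²Δ-disjoint sizes F₁∈𝓕 F₂∈𝓕 F₁∩F₂≡∅
  ... | no no-disjoint-pair = ℕ.≤-trans
    (length≤k²Δ-intersecting sizes F₀∈𝓕 intersecting (avoiding unique sizes large))
    (ℕ.m≤n+m _ (d 𝓕 + d 𝓕))
    where
    F₀∈𝓕 = ∈-lookup (fromℕ< (ℕ.<-≤-trans (s≤s z≤n) large))
    intersecting : ∀ {G H} → G ∈ˡ 𝓕 → H ∈ˡ 𝓕 → G ∩ H ≢ ∅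
    intersecting G∈𝓕 H∈𝓕 G∩H≡∅ = no-disjoint-pair (lose G∈𝓕 (lose H∈𝓕 G∩H≡∅))

-- For k = 1 the binomial inequality fails (k ∸ 2 truncates to 0), but then no member
-- contains a pair, so Δ = 0.
Δ*C-ratio≤ : ∀ n k Δ → 1 < 2 * k → 2 * k ≤ n → (k ≡ 1 → Δ ≡ 0) →
  Δ * (((n ∸ 2) C (k ∸ 2)) * n) ≤ Δ * (k * ((n ∸ 1) C (k ∸ 1)))
Δ*C-ratio≤ n 1 Δ _ _ k≡1⇒Δ≡0 rewrite k≡1⇒Δ≡0 refl = z≤n
Δ*C-ratio≤ (suc (suc m)) (suc (suc j)) Δ _ 2k≤n _ =
  ℕ.*-monoʳ-≤ Δ (nCk*[n+2]≤[k+2]*[n+1]C[k+1] m j (ℕ.≤-pred (ℕ.≤-pred (ℕ.≤-trans (ℕ.m≤m+n _ _) 2k≤n))))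
Δ*C-ratio≤ zero (suc (suc j)) Δ _ () _
Δ*C-ratio≤ (suc zero) (suc (suc j)) Δ _ (s≤s ()) _

lemma1 : (n k : ℕ) → 1 < 2 * k → 2 * k ≤ n →
    (𝓕 : List (Subset n)) → Unique 𝓕 → All (λ F → ∣ F ∣ ≡ k) 𝓕 →
    (n ∸ 1) C (k ∸ 1) < length 𝓕 →
    (½ *ℚ (1ℚ -ℚ ((c n k 2 𝓕 *ℚ toℚ (k ^ 3)) ÷ℚ (γ n k 𝓕 *ℚ toℚ n)))) *ℚ toℚ (length 𝓕)
      ≤ℚ toℚ (d 𝓕)
lemma1 n zero () _
lemma1 n (suc k) 1<2k 2k≤n 𝓕 unique sizes large =
  half-deficit≤ q (length 𝓕) (d 𝓕) (suc k * (suc k * Δ))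
    (deficit-lower-bound Δ ((n ∸ 2) C (k ∸ 1)) ((n ∸ 1) C k) (length 𝓕) n (suc k)
      (nCk>0 (n ∸ 2) (k ∸ 1) (ℕ.∸-monoˡ-≤ 2 k<n)) (nCk>0 (n ∸ 1) k (ℕ.∸-monoˡ-≤ 1 k<n))
      (ℕ.<-≤-trans (s≤s z≤n) large) (ℕ.≤-trans (s≤s z≤n) k<n)
      (Δ*C-ratio≤ n (suc k) Δ 1<2k 2k≤n Δ≡0-if-k≡1))
    (length≤2d+k²Δ 𝓕 unique sizes large)
  where
  Δ = maxLink 2 𝓕
  q = (c n (suc k) 2 𝓕 *ℚ toℚ (suc k ^ 3)) ÷ℚ (γ n (suc k) 𝓕 *ℚ toℚ n)
  k<n : suc k ≤ n
  k<n = ℕ.≤-trans (ℕ.m≤m+n (suc k) (suc k + 0)) 2k≤n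
  Δ≡0-if-k≡1 : suc k ≡ 1 → Δ ≡ 0
  Δ≡0-if-k≡1 refl = maxLink≡0 𝓕 2 (All.map (ℕ.≤-reflexive ∘ cong suc) sizes)
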